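{- Let $1\le u<s\le n$, let $x\in P_{n,u}\setminus P_{n,0}$ and $y\in P_{n,s}\setminus P_{n,u}$ with either $\mathrm{rk}(y)=\mathrm{rk}(x)+1$ or $\mathrm{rk}(x)=\mathrm{rk}(y)+1$. Then in either case there is no cover relation (edge of the Hasse diagram of $\Pi_n^B$) between $x$ and $y$.
   Context: $\Pi_n^B$ is the set of partitions $\pi$ of $\{ -n,\dots,n\}$ such that (1) $B\in\pi$ implies $-B\in\pi$, and (2) if $i,-i\in B$ for some $i$ and some block $B$, then $0\in B$; ordered by refinement and graded by $\mathrm{rk}(\pi)=n-(|\pi|-1)/2$. For $0\le s\le n$, $P_{n,s}$ is the subposet of all $\pi\in\Pi_n^B$ having no block equal to $\{k,0,-k\}$ for any $k\in\{s+1,\dots,n\}$; it is isomorphic to the intersection lattice of $\mathcal D_{n,s}$ (normals $e_i\pm e_j$, $i<j$, and $e_i$, $i\le s$), and $P_{n,0}$ corresponds to $\mathcal D_n$. -}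

module Defs where

open import Data.Nat using (ℕ; zero; suc; _+_; _*_; _∸_; _≤_; _<ᵇ_; ⌊_/2⌋)
open import Data.Fin using (Fin; toℕ)
open import Data.Fin.Base using () renaming (zero to fzero)
open import Data.List using (List; []; _∷_; map; _++_; length; filterᵇ; allFin)
open import Data.Bool.ListAction using (any)
open import Data.Bool using (Bool; true; false; T; not; _∧_)
open import Data.Product using (Σ; _×_)
open import Data.Sum using (_⊎_)
open import Relation.Nullary using (¬_)
open import Relation.Binary.PropositionalEquality using (_≡_)

-- Ground set {-n,…,n}:  zero ↦ 0,  pos i ↦ i+1,  neg i ↦ -(i+1)   (i : Fin n)
data El (n : ℕ) : Set where
  zero : El n
  pos  : Fin n → El n
  neg  : Fin n → El n

negate : ∀ {n} → El n → El n
negate zero    = zero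
negate (pos i) = neg i
negate (neg i) = pos i

allEl : (n : ℕ) → List (El n)
allEl n = zero ∷ (map pos (allFin n) ++ map neg (allFin n))

code : ∀ {n} → El n → ℕ
code zero    = 0
code (pos i) = suc (2 * toℕ i)
code (neg i) = suc (suc (2 * toℕ i))

-- A set partition of {-n,…,n} given by its (decidable) equivalence relation
-- "i and j lie in the same block".
BRel : ℕ → Set
BRel n = El n → El n → Bool

record IsTypeB {n : ℕ} (π : BRel n) : Set where
  field
    reflexive  : ∀ i → T (π i i)
    symmetric  : ∀ i j → T (π i j) → T (π j i)
    transitive : ∀ i j k → T (π i j) → T (π j k) → T (π i k)
    -- (1) B ∈ π implies -B ∈ π
    negClosed  : ∀ i j → T (π i j) → T (π (negate i) (negate j))
    -- (2) i, -i in the same block B implies 0 ∈ B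
    zeroCond   : ∀ i → T (π i (negate i)) → T (π i zero)

_⊑_ : ∀ {n} → BRel n → BRel n → Set
π ⊑ σ = ∀ i j → T (π i j) → T (σ i j)

_⊏_ : ∀ {n} → BRel n → BRel n → Set
π ⊏ σ = π ⊑ σ × ¬ (σ ⊑ π)

Covers : ∀ {n} → BRel n → BRel n → Set
Covers {n} π σ = π ⊏ σ × ¬ (Σ (BRel n) λ ρ → IsTypeB ρ × π ⊏ ρ × ρ ⊏ σ)

-- number of blocks |π| : count elements that are the first (w.r.t. code) of their block
isLeader : ∀ {n} → BRel n → El n → Bool
isLeader {n} π i = not (any (λ j → (code j <ᵇ code i) ∧ π j i) (allEl n))

numBlocks : ∀ {n} → BRel n → ℕ
numBlocks {n} π = length (filterᵇ (isLeader π) (allEl n))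

rk : ∀ {n} → BRel n → ℕ
rk {n} π = n ∸ ⌊ numBlocks π ∸ 1 /2⌋

-- the block of π containing 0 is exactly {k, 0, -k}, where k = toℕ i + 1
ZeroBlockIs : ∀ {n} → BRel n → Fin n → Set
ZeroBlockIs {n} π i =
  ∀ j → T (π zero j) ⇔' ((j ≡ zero) ⊎ (j ≡ pos i) ⊎ (j ≡ neg i))
  where
    _⇔'_ : Set → Set → Set
    A ⇔' B = (A → B) × (B → A)

-- π ∈ P_{n,s}: π ∈ Π_n^B with no block {k,0,-k} for k ∈ {s+1,…,n}
InP : (n s : ℕ) → BRel n → Set
InP n s π = IsTypeB π × ¬ (Σ (Fin n) λ i → (s ≤ toℕ i) × ZeroBlockIs π i)

module Submission where

-- A block {k,0,-k} is the block of 0, so its k is the same for any two comparable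
-- partitions that both have such a block: refining cannot change it without
-- changing the block of 0 to something else.  Now x ∉ P_{n,0} has such a block with
-- k ≤ u (as x ∈ P_{n,u}), and y ∉ P_{n,u} has one with k > u.  Hence x and y are
-- not even comparable, whatever their ranks, so neither covers the other.

open import Defs
open import Data.Nat using (ℕ; suc; _≤_; _<_)
open import Data.Fin using (Fin; toℕ)
open import Data.Product using (_×_; _,_; Σ; proj₁; proj₂)
open import Data.Sum using (_⊎_; inj₁; inj₂)
open import Relation.Nullary using (¬_)
open import Relation.Binary.PropositionalEquality using (_≡_; refl; sym; subst)

Comparable : ∀ {n} → BRel n → BRel n → Set
Comparable π σ = π ⊑ σ ⊎ σ ⊑ π

zeroBlockIs-unique-⊑ : ∀ {n} {π σ : BRel n} {i j : Fin n} →
  π ⊑ σ → ZeroBlockIs π i → ZeroBlockIs σ j → i ≡ j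
zeroBlockIs-unique-⊑ {i = i} π⊑σ zπ zσ
  with proj₁ (zσ (pos i)) (π⊑σ zero (pos i) (proj₂ (zπ (pos i)) (inj₂ (inj₁ refl))))
... | inj₂ (inj₁ refl) = refl

zeroBlockIs-unique : ∀ {n} {π σ : BRel n} {i j : Fin n} →
  Comparable π σ → ZeroBlockIs π i → ZeroBlockIs σ j → i ≡ j
zeroBlockIs-unique (inj₁ π⊑σ) zπ zσ = zeroBlockIs-unique-⊑ π⊑σ zπ zσ
zeroBlockIs-unique (inj₂ σ⊑π) zπ zσ = sym (zeroBlockIs-unique-⊑ σ⊑π zσ zπ)

InP∖InP-incomparable : ∀ {n u} {x y : BRel n} → IsTypeB y →
  InP n u x → ¬ InP n 0 x → ¬ InP n u y → ¬ Comparable x y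
InP∖InP-incomparable {u = u} ty (tx , x∈P) x∉P₀ y∉P x≶y =
  x∉P₀ (tx , λ { (i , _ , zx) →
  y∉P (ty , λ { (j , u≤j , zy) →
  x∈P (i , subst (λ k → u ≤ toℕ k) (sym (zeroBlockIs-unique x≶y zx zy)) u≤j , zx) }) })

Covers⇒⊑ : ∀ {n} {π σ : BRel n} → Covers π σ → π ⊑ σ
Covers⇒⊑ ((π⊑σ , _) , _) = π⊑σ

lemma4p26 : (n u s : ℕ) → 1 ≤ u → u < s → s ≤ n →
    (x y : BRel n) →
    InP n u x → ¬ InP n 0 x →
    InP n s y → ¬ InP n u y →
    (rk y ≡ suc (rk x)) ⊎ (rk x ≡ suc (rk y)) →
    ¬ Covers x y × ¬ Covers y x
lemma4p26 n u s _ _ _ x y x∈P x∉P₀ (ty , _) y∉P _ =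
  (λ x⋖y → incomparable (inj₁ (Covers⇒⊑ x⋖y))) ,
  (λ y⋖x → incomparable (inj₂ (Covers⇒⊑ y⋖x)))
  where
    incomparable : ¬ Comparable x y
    incomparable = InP∖InP-incomparable ty x∈P x∉P₀ y∉P
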